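{- Let $p$ be a prime number with $p = 4k+1$ for an integer $k$. There exist positive integers $d, u, v$ such that $(du, dv, duv)$ is a solution for $p$ (that is, $\frac{4}{p} = \frac{1}{du} + \frac{1}{dv} + \frac{1}{duv}$ with $du \le dv \le duv$) if and only if there exist an integer $t \ge 0$ and a positive divisor $w$ of $k+1+t$ such that $w \equiv -1 \pmod{3+4t}$. In particular, if $k+1$ has a positive divisor $w$ with $w \equiv 2 \pmod 3$, then there exist positive integers $d,u,v$ such that $(du, dv, duv)$ is a solution for $p$.
   Context: For a positive integer $p$, a solution for $p$ is a triple $(x,y,z)$ of positive integers with $x \le y \le z$ and $\frac{4}{p} = \frac{1}{x} + \frac{1}{y} + \frac{1}{z}$. -}

module Defs where

open import Data.Nat using (ℕ; _+_; _*_; _≤_; _<_)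
open import Data.Product using (_×_)
open import Relation.Binary.PropositionalEquality using (_≡_)

-- (x , y , z) is a solution for p: x, y, z positive integers, x ≤ y ≤ z,
-- and 4/p = 1/x + 1/y + 1/z.  Since p, x, y, z are positive, the equation
-- is equivalent to its cleared-denominators form  4xyz = p(yz + xz + xy).
IsSolution : ℕ → ℕ → ℕ → ℕ → Set
IsSolution p x y z =
  (0 < x) × (0 < y) × (0 < z) × (x ≤ y) × (y ≤ z) ×
  (4 * x * y * z ≡ p * (y * z + x * z + x * y))

{-# OPTIONS --safe #-}
-- Dividing the equation of a solution (du, dv, duv) by d²uv leaves 4duv = p(u + v + 1).
-- The prime p divides neither 4 nor d (the latter would make 4duv exceed p(u + v + 1)),
-- so up to the symmetry u ↔ v it divides v = sp, and 4dus = u + sp + 1.  This forces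
-- du > k; writing du = k + 1 + t the equation becomes s(3 + 4t) = u + 1, so w = u is
-- the required divisor.  Conversely, from k + 1 + t = aw and w + 1 = b(3 + 4t) the
-- triple (d, u, v) = (a, w, pb) satisfies 4duv = p(u + v + 1).
module Submission where

open import Defs
open import Data.Nat using (ℕ; zero; suc; _+_; _*_; _∸_; _<_; _≤_; _%_; _/_; z≤n; s≤s; z<s; NonZero; >-nonZero; >-nonZero⁻¹)
open import Data.Nat.Properties
open import Data.Nat.Divisibility using (_∣_; divides; >⇒∤)
open import Data.Nat.DivMod using (m≡m%n+[m/n]*n)
open import Data.Nat.Primality using (Prime; euclidsLemma; ¬prime[1]; prime⇒nonZero)
open import Data.Nat.Tactic.RingSolver using (solve-∀)
open import Data.Product using (_×_; _,_; ∃-syntax)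
open import Data.Sum using (inj₁; inj₂)
open import Data.Empty using (⊥-elim)
open import Function.Bundles using (_⇔_; mk⇔)
open import Relation.Nullary using (¬_)
open import Relation.Binary.PropositionalEquality using (_≡_; refl; sym; trans; cong; subst; module ≡-Reasoning)

ScaledEquation : ℕ → ℕ → ℕ → ℕ → Set
ScaledEquation p d u v = 4 * d * u * v ≡ p * (u + v + 1)

HasScaledSolution : ℕ → Set
HasScaledSolution p =
  ∃[ d ] ∃[ u ] ∃[ v ] (0 < d) × (0 < u) × (0 < v) × IsSolution p (d * u) (d * v) (d * u * v)

DivisorCondition : ℕ → Set
DivisorCondition k = ∃[ t ] ∃[ w ] (0 < w) × (w ∣ k + 1 + t) × ((3 + 4 * t) ∣ w + 1)

xyz-scaled : ∀ d u v → 4 * (d * u) * (d * v) * (d * u * v) ≡ 4 * d * u * v * (d * u * (d * v))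
xyz-scaled = solve-∀

yz+xz+xy-scaled : ∀ p d u v →
  p * (d * v * (d * u * v) + d * u * (d * u * v) + d * u * (d * v)) ≡ p * (u + v + 1) * (d * u * (d * v))
yz+xz+xy-scaled = solve-∀

isSolution⇒scaledEquation : ∀ p d u v → IsSolution p (d * u) (d * v) (d * u * v) → ScaledEquation p d u v
isSolution⇒scaledEquation p d u v (du>0 , dv>0 , _ , _ , _ , eq) =
  *-cancelʳ-≡ _ _ (d * u * (d * v)) {{m*n≢0 _ _ {{>-nonZero du>0}} {{>-nonZero dv>0}}}}
    (trans (sym (xyz-scaled d u v)) (trans eq (yz+xz+xy-scaled p d u v)))

scaledEquation⇒isSolution : ∀ {p d u v} → 0 < d → 0 < u → 0 < v → u ≤ v →
  ScaledEquation p d u v → IsSolution p (d * u) (d * v) (d * u * v)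
scaledEquation⇒isSolution {p} {d@(suc _)} {u@(suc _)} {v@(suc _)} _ _ _ u≤v eq =
  z<s , z<s , z<s , *-monoʳ-≤ d u≤v , *-monoˡ-≤ v (m≤m*n d u) ,
  trans (xyz-scaled d u v) (trans (cong (_* (d * u * (d * v))) eq) (sym (yz+xz+xy-scaled p d u v)))

scaledEquation-swap : ∀ {p d u v} → ScaledEquation p d u v → ScaledEquation p d v u
scaledEquation-swap {p} {d} {u} {v} eq = begin
  4 * d * v * u     ≡⟨ *-assoc (4 * d) v u ⟩
  4 * d * (v * u)   ≡⟨ cong (4 * d *_) (*-comm v u) ⟩
  4 * d * (u * v)   ≡⟨ *-assoc (4 * d) u v ⟨
  4 * d * u * v     ≡⟨ eq ⟩
  p * (u + v + 1)   ≡⟨ cong (λ n → p * (n + 1)) (+-comm u v) ⟩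
  p * (v + u + 1)   ∎
  where open ≡-Reasoning

scaledEquation⇒hasScaledSolution : ∀ {p d u v} → 0 < d → 0 < u → 0 < v →
  ScaledEquation p d u v → HasScaledSolution p
scaledEquation⇒hasScaledSolution {p} {d} {u} {v} d>0 u>0 v>0 eq with ≤-total u v
... | inj₁ u≤v = d , u , v , d>0 , u>0 , v>0 , scaledEquation⇒isSolution {p} d>0 u>0 v>0 u≤v eq
... | inj₂ v≤u = d , v , u , d>0 , v>0 , u>0 ,
  scaledEquation⇒isSolution {p} d>0 v>0 u>0 v≤u (scaledEquation-swap {p} {d} {u} eq)

u+v+1<4euv : ∀ {e u v} → 0 < e → 0 < u → 0 < v → u + v + 1 < 4 * e * u * v
u+v+1<4euv {suc e} {suc u} {suc v} _ _ _ =
  subst (suc u + suc v + 1 <_) (sym (expand e u v)) (m<m+n (suc u + suc v + 1) z<s)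
  where
  expand : ∀ e u v → 4 * suc e * suc u * suc v ≡
    suc u + suc v + 1 + suc (3 * u + 3 * v + 4 * u * v + 4 * e * suc u * suc v)
  expand = solve-∀

¬scaledEquation-p∣d : ∀ {p e u v} .{{_ : NonZero p}} → 0 < e → 0 < u → 0 < v →
  ¬ ScaledEquation p (e * p) u v
¬scaledEquation-p∣d {p} {e} {u} {v} e>0 u>0 v>0 eq =
  <-irrefl (trans (sym eq) (pull-p p e u v)) (*-monoʳ-< p (u+v+1<4euv e>0 u>0 v>0))
  where
  pull-p : ∀ p e u v → 4 * (e * p) * u * v ≡ p * (4 * e * u * v)
  pull-p = solve-∀

prime4k+1∤4 : ∀ k → Prime (4 * k + 1) → ¬ (4 * k + 1 ∣ 4)
prime4k+1∤4 zero    pr = ⊥-elim (¬prime[1] pr)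
prime4k+1∤4 (suc k) _  = >⇒∤ (+-monoˡ-≤ 1 (*-monoʳ-≤ 4 (s≤s z≤n)))

k<du : ∀ k d u s → 4 * d * u * s ≡ u + s * (4 * k + 1) + 1 → k < d * u
k<du k d u s eq = ≰⇒> λ du≤k → <-irrefl eq (begin-strict
  4 * d * u * s           ≡⟨ cong (_* s) (*-assoc 4 d u) ⟩
  4 * (d * u) * s         ≤⟨ *-monoˡ-≤ s (*-monoʳ-≤ 4 du≤k) ⟩
  4 * k * s               ≡⟨ *-comm (4 * k) s ⟩
  s * (4 * k)             ≤⟨ *-monoʳ-≤ s (m≤m+n (4 * k) 1) ⟩
  s * (4 * k + 1)         ≤⟨ m≤n+m (s * (4 * k + 1)) u ⟩
  u + s * (4 * k + 1)     <⟨ m<m+n (u + s * (4 * k + 1)) z<s ⟩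
  u + s * (4 * k + 1) + 1 ∎)
  where open ≤-Reasoning

divisorCondition-of-p∣v : ∀ {k d u s} → 0 < u →
  ScaledEquation (4 * k + 1) d u (s * (4 * k + 1)) → DivisorCondition k
divisorCondition-of-p∣v {k} {d} {u} {s} u>0 eq =
  t , u , u>0 , divides d du≡k+1+t , divides s (sym s[3+4t]≡u+1)
  where
  open ≡-Reasoning
  instance
    4k+1≢0 : NonZero (4 * k + 1)
    4k+1≢0 = >-nonZero (m≤n+m 1 (4 * k))
  pull-p : ∀ p d u s → 4 * d * u * (s * p) ≡ p * (4 * d * u * s)
  pull-p = solve-∀
  reduced : 4 * d * u * s ≡ u + s * (4 * k + 1) + 1
  reduced = *-cancelˡ-≡ _ _ (4 * k + 1) (trans (sym (pull-p (4 * k + 1) d u s)) eq)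
  t = d * u ∸ (k + 1)
  du≡k+1+t : k + 1 + t ≡ d * u
  du≡k+1+t = m+[n∸m]≡n (subst (_≤ d * u) (+-comm 1 k) (k<du k d u s reduced))
  split-4[k+1+t] : ∀ k t s → s * (4 * k + 1) + s * (3 + 4 * t) ≡ 4 * (k + 1 + t) * s
  split-4[k+1+t] = solve-∀
  regroup : ∀ u q → u + q + 1 ≡ q + (u + 1)
  regroup = solve-∀
  s[3+4t]≡u+1 : s * (3 + 4 * t) ≡ u + 1
  s[3+4t]≡u+1 = +-cancelˡ-≡ (s * (4 * k + 1)) _ _ (begin
    s * (4 * k + 1) + s * (3 + 4 * t) ≡⟨ split-4[k+1+t] k t s ⟩
    4 * (k + 1 + t) * s               ≡⟨ cong (λ n → 4 * n * s) du≡k+1+t ⟩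
    4 * (d * u) * s                   ≡⟨ cong (_* s) (*-assoc 4 d u) ⟨
    4 * d * u * s                     ≡⟨ reduced ⟩
    u + s * (4 * k + 1) + 1           ≡⟨ regroup u (s * (4 * k + 1)) ⟩
    s * (4 * k + 1) + (u + 1)         ∎)

scaledEquation⇒divisorCondition : ∀ {k d u v} → Prime (4 * k + 1) → 0 < d → 0 < u → 0 < v →
  ScaledEquation (4 * k + 1) d u v → DivisorCondition k
scaledEquation⇒divisorCondition {k} {d} {u} {v} pr d>0 u>0 v>0 eq
  with euclidsLemma (4 * d * u) v pr (divides (u + v + 1) (trans eq (*-comm (4 * k + 1) _)))
... | inj₂ (divides s refl) = divisorCondition-of-p∣v {k} {d} {u} {s} u>0 eq
... | inj₁ p∣4du with euclidsLemma (4 * d) u pr p∣4du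
...   | inj₂ (divides s refl) =
  divisorCondition-of-p∣v {k} {d} {v} {s} v>0 (scaledEquation-swap {4 * k + 1} {d} {u} eq)
...   | inj₁ p∣4d with euclidsLemma 4 d pr p∣4d
...     | inj₁ p∣4 = ⊥-elim (prime4k+1∤4 k pr p∣4)
...     | inj₂ (divides e refl) = ⊥-elim
  (¬scaledEquation-p∣d {{prime⇒nonZero pr}} (>-nonZero⁻¹ e {{m*n≢0⇒m≢0 e {{>-nonZero d>0}}}}) u>0 v>0 eq)

hasScaledSolution⇒divisorCondition : ∀ {k} → Prime (4 * k + 1) → HasScaledSolution (4 * k + 1) → DivisorCondition k
hasScaledSolution⇒divisorCondition {k} pr (d , u , v , d>0 , u>0 , v>0 , sol) =
  scaledEquation⇒divisorCondition pr d>0 u>0 v>0 (isSolution⇒scaledEquation (4 * k + 1) d u v sol)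

quotient-pos : ∀ {n m} q → n ≡ q * m → 0 < n → 0 < q
quotient-pos zero    refl ()
quotient-pos (suc _) _    _ = z<s

divisorCondition⇒hasScaledSolution : ∀ {k} → DivisorCondition k → HasScaledSolution (4 * k + 1)
divisorCondition⇒hasScaledSolution {k} (t , w , w>0 , divides a k+1+t≡aw , divides b w+1≡b[3+4t]) =
  scaledEquation⇒hasScaledSolution {p} a>0 w>0 pb>0 (begin
    4 * a * w * (p * b)                ≡⟨ gather a w b p ⟩
    p * b * (4 * (a * w))              ≡⟨ cong (λ n → p * b * (4 * n)) k+1+t≡aw ⟨
    p * b * (4 * (k + 1 + t))          ≡⟨ split-4[k+1+t] k t b ⟩
    p * (b * (3 + 4 * t) + p * b)      ≡⟨ cong (λ n → p * (n + p * b)) w+1≡b[3+4t] ⟨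
    p * (w + 1 + p * b)                ≡⟨ regroup p w b ⟩
    p * (w + p * b + 1)                ∎)
  where
  open ≡-Reasoning
  p = 4 * k + 1
  a>0 : 0 < a
  a>0 = quotient-pos a k+1+t≡aw (≤-trans (m≤n+m 1 k) (m≤m+n (k + 1) t))
  pb>0 : 0 < p * b
  pb>0 = >-nonZero⁻¹ (p * b)
    {{m*n≢0 p b {{>-nonZero (m≤n+m 1 (4 * k))}} {{>-nonZero (quotient-pos b w+1≡b[3+4t] (m≤n+m 1 w))}}}}
  gather : ∀ a w b p → 4 * a * w * (p * b) ≡ p * b * (4 * (a * w))
  gather = solve-∀
  split-4[k+1+t] : ∀ k t b → (4 * k + 1) * b * (4 * (k + 1 + t)) ≡
    (4 * k + 1) * (b * (3 + 4 * t) + (4 * k + 1) * b)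
  split-4[k+1+t] = solve-∀
  regroup : ∀ p w b → p * (w + 1 + p * b) ≡ p * (w + p * b + 1)
  regroup = solve-∀

m%n+1≡n⇒n∣m+1 : ∀ m n .{{_ : NonZero n}} → m % n + 1 ≡ n → n ∣ m + 1
m%n+1≡n⇒n∣m+1 m n m%n+1≡n = divides (suc (m / n)) (begin
  m + 1                    ≡⟨ cong (_+ 1) (m≡m%n+[m/n]*n m n) ⟩
  m % n + m / n * n + 1    ≡⟨ +-assoc (m % n) (m / n * n) 1 ⟩
  m % n + (m / n * n + 1)  ≡⟨ cong (m % n +_) (+-comm (m / n * n) 1) ⟩
  m % n + (1 + m / n * n)  ≡⟨ +-assoc (m % n) 1 (m / n * n) ⟨
  m % n + 1 + m / n * n    ≡⟨ cong (_+ m / n * n) m%n+1≡n ⟩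
  n + m / n * n            ∎)
  where open ≡-Reasoning

divisor≡2mod3⇒divisorCondition : ∀ {k} → (∃[ w ] (0 < w) × (w ∣ k + 1) × (w % 3 ≡ 2)) → DivisorCondition k
divisor≡2mod3⇒divisorCondition {k} (w , w>0 , w∣k+1 , w%3≡2) =
  0 , w , w>0 , subst (w ∣_) (sym (+-identityʳ (k + 1))) w∣k+1 , m%n+1≡n⇒n∣m+1 w 3 (cong (_+ 1) w%3≡2)

mainTheorem3 : (p k : ℕ) → Prime p → p ≡ 4 * k + 1 →
    ((∃[ d ] ∃[ u ] ∃[ v ] (0 < d) × (0 < u) × (0 < v) × IsSolution p (d * u) (d * v) (d * u * v))
      ⇔ (∃[ t ] ∃[ w ] (0 < w) × (w ∣ k + 1 + t) × ((3 + 4 * t) ∣ w + 1)))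
    × ((∃[ w ] (0 < w) × (w ∣ k + 1) × (w % 3 ≡ 2)) →
       ∃[ d ] ∃[ u ] ∃[ v ] (0 < d) × (0 < u) × (0 < v) × IsSolution p (d * u) (d * v) (d * u * v))
mainTheorem3 .(4 * k + 1) k pr refl =
  mk⇔ (hasScaledSolution⇒divisorCondition pr) divisorCondition⇒hasScaledSolution ,
  λ w → divisorCondition⇒hasScaledSolution (divisor≡2mod3⇒divisorCondition w)
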